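{- Let $r,c$ be odd positive integers, and for a white vertex $h$ of the $r\times c$ grid graph let $a(r,c;h)$ be the number of near-perfect matchings of the grid in which $h$ is unmatched. (a) If the white vertex $h$ is even, then $a(r,c;h)$ is even. (b) If $h_1,h_2$ are any two odd white vertices, then $a(r,c;h_1)\equiv a(r,c;h_2)\pmod 2$.
   Context: The $r\times c$ grid graph has vertex set $\{1,\dots,r\}\times\{1,\dots,c\}$, with two vertices adjacent when they differ by $1$ in exactly one coordinate. A near-perfect matching is a set of pairwise disjoint edges covering all vertices but one. With $r,c$ odd, a vertex $(i,j)$ is white if $i+j$ is even (majority color of the checkerboard coloring). A white vertex $(i,j)$ is odd if $i,j$ are both odd and even if $i,j$ are both even. -}

module Defs where

open import Data.Bool using (Bool; true; false; _∧_; _∨_; if_then_else_)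
open import Data.Nat using (ℕ; zero; suc; _∸_; _≡ᵇ_)
open import Data.List using (List; []; _∷_; _++_; map; length; concatMap; upTo)
open import Data.Product using (_×_; _,_; proj₁; proj₂)

-- Vertices of the grid are pairs (i , j) of natural numbers, 1-indexed
-- as in the paper: the r × c grid has vertex set {1..r} × {1..c}.
Vertex : Set
Vertex = ℕ × ℕ

Edge : Set
Edge = Vertex × Vertex

range1 : ℕ → List ℕ
range1 n = map suc (upTo n)

gridVertices : ℕ → ℕ → List Vertex
gridVertices r c = concatMap (λ i → map (λ j → (i , j)) (range1 c)) (range1 r)

gridEdges : ℕ → ℕ → List Edge
gridEdges r c =
  concatMap (λ i → map (λ j → ((i , j) , (i , suc j))) (range1 (c ∸ 1))) (range1 r)
  ++ concatMap (λ i → map (λ j → ((i , j) , (suc i , j))) (range1 c)) (range1 (r ∸ 1))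

countᵇ : {A : Set} → (A → Bool) → List A → ℕ
countᵇ p []       = 0
countᵇ p (x ∷ xs) = if p x then suc (countᵇ p xs) else countᵇ p xs

allᵇ : {A : Set} → (A → Bool) → List A → Bool
allᵇ p []       = true
allᵇ p (x ∷ xs) = p x ∧ allᵇ p xs

-- all sub-lists (= subsets, since the edge list has no repetitions)
subsets : {A : Set} → List A → List (List A)
subsets []       = [] ∷ []
subsets (x ∷ xs) = let s = subsets xs in s ++ map (x ∷_) s

_==ᵛ_ : Vertex → Vertex → Bool
(i , j) ==ᵛ (k , l) = (i ≡ᵇ k) ∧ (j ≡ᵇ l)

incident : Vertex → Edge → Bool
incident v (u , w) = (v ==ᵛ u) ∨ (v ==ᵛ w)

degree : List Edge → Vertex → ℕ
degree S v = countᵇ (incident v) S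

-- S is a near-perfect matching of the r × c grid whose unmatched vertex is h:
-- every grid vertex other than h lies in exactly one edge of S, and h in none.
-- (Edges of S are grid edges, so this says: pairwise disjoint edges covering
-- all vertices except exactly h.)
isNPMHole : ℕ → ℕ → Vertex → List Edge → Bool
isNPMHole r c h S =
  allᵇ (λ v → degree S v ≡ᵇ (if v ==ᵛ h then 0 else 1)) (gridVertices r c)

a : ℕ → ℕ → Vertex → ℕ
a r c h = countᵇ (isNPMHole r c h) (subsets (gridEdges r c))

{-# OPTIONS --safe #-}
-- Write m(U) for the number of perfect matchings of the subgraph induced by a vertex set U.
-- Expanding along a vertex v ∈ U gives m(U) = Σ_{w ~ v, w ∈ U} m(U ∖ {v, w}).  Expanding every term
-- of Σ_{w ~ v, w ∈ U} m(U ∖ w) once more along v gives a double sum over pairs of neighbours of v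
-- that is symmetric and vanishes on the diagonal, so that sum is even.
-- Now let U contain every black vertex.  For an odd white x ∉ U, m(U ∪ x) = Σ_{w ~ x} m(U ∖ w), and
-- for an odd white x ∈ U the same sum is even; hence, mod 2,
--   Σ_{x odd white, x ∉ U} m(U ∪ x) ≡ Σ_{x odd white} Σ_{w ~ x} m(U ∖ w) = Σ_{w black} N(w) m(U ∖ w),
-- where N(w) is the number of odd white neighbours of w, which is 2 in an odd × odd grid.
-- For U = all vertices but the white vertices h₁ ≠ h₂ this reads [h₁ odd] a(h₂) + [h₂ odd] a(h₁) ≡ 0;
-- h₁ = (1,1) and h₂ even gives (a), and h₁, h₂ odd gives (b).
module Submission where

open import Defs
open import Algebra.Bundles using (CommutativeMonoid)
import Algebra.Properties.CommutativeSemigroup as CommutativeSemigroupProperties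
open import Data.Bool using (Bool; true; false; not; _∧_; _∨_; _xor_; if_then_else_; T)
open import Data.Bool.Properties
  using (not-involutive; not-distribˡ-xor; not-distribʳ-xor; xor-same; ∧-zeroʳ; ∧-identityʳ; ∨-zeroʳ; ∨-comm;
         ∧-conicalˡ; ∧-commutativeMonoid; T-≡)
open import Data.List using (List; []; _∷_; _++_; map; concat; concatMap; upTo)
open import Data.List.Membership.Propositional using (_∈_; find)
open import Data.List.Membership.Propositional.Properties
  using (∈-map⁺; ∈-map⁻; ∈-upTo⁺; ∈-upTo⁻; ∈-concatMap⁺; ∈-concatMap⁻; ∈-++⁻)
open import Data.List.Properties using (map-applyUpTo)
import Data.List.Relation.Unary.Any as Any
open import Data.List.Relation.Unary.Any using (here; there)
open import Data.Nat using (ℕ; zero; suc; _+_; _≡ᵇ_; _%_; _≤_; z≤n; s≤s)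
open import Data.Nat.DivMod using ([m+n]%n≡m%n)
open import Data.Nat.Properties
  using (m≤n⇒m≤1+n; +-comm; +-assoc; +-identityʳ; +-suc; +-commutativeSemigroup; ≡ᵇ⇒≡; ≡⇒≡ᵇ)
open import Data.Product using (_×_; _,_; ∃; proj₁; proj₂)
open import Data.Sum using (inj₁; inj₂)
open import Function using (_∘_; id)
open import Function.Bundles using (Equivalence)
open import Relation.Binary.PropositionalEquality
  using (_≡_; refl; sym; trans; cong; cong₂; subst; subst₂; module ≡-Reasoning)

open CommutativeSemigroupProperties +-commutativeSemigroup using (interchange)
open CommutativeSemigroupProperties (CommutativeMonoid.commutativeSemigroup ∧-commutativeMonoid) using (xy∙z≈xz∙y)

private variable
  A B : Set

-- Iverson brackets, parity and finite sums

infixr 7 [_]·_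

[_]·_ : Bool → ℕ → ℕ
[ b ]· n = if b then n else 0

[]·-∧ : ∀ a b n → [ a ∧ b ]· n ≡ [ a ]· [ b ]· n
[]·-∧ true  b n = refl
[]·-∧ false b n = refl

[]·-+ : ∀ b m n → [ b ]· (m + n) ≡ [ b ]· m + [ b ]· n
[]·-+ true  m n = refl
[]·-+ false m n = refl

[]·-zero : ∀ b → [ b ]· 0 ≡ 0
[]·-zero true  = refl
[]·-zero false = refl

[]·-cong : ∀ b {m n} → (b ≡ true → m ≡ n) → [ b ]· m ≡ [ b ]· n
[]·-cong true  eq = eq refl
[]·-cong false eq = refl

[]·-exchange : ∀ a b c d i n → a ∧ b ≡ c ∧ d → [ a ]· [ i ∧ b ]· n ≡ [ i ∧ c ]· [ d ]· n
[]·-exchange a b c d true  n eq = trans (sym ([]·-∧ a b n)) (trans (cong ([_]· n) eq) ([]·-∧ c d n))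
[]·-exchange a b c d false n eq = []·-zero a

[]·-guard-swap : ∀ a b c d n x → [ a ∧ b ]· [ c ∧ (d ∧ n) ]· x ≡ [ c ∧ d ]· [ a ∧ (b ∧ n) ]· x
[]·-guard-swap true  true  true  true  n x = refl
[]·-guard-swap true  true  true  false n x = refl
[]·-guard-swap true  true  false d     n x = refl
[]·-guard-swap true  false c     d     n x = sym ([]·-zero (c ∧ d))
[]·-guard-swap false b     c     d     n x = sym ([]·-zero (c ∧ d))

∧-not-∨ : ∀ a b c → a ∧ not (b ∨ c) ≡ (a ∧ not b) ∧ not c
∧-not-∨ false b     c = refl
∧-not-∨ true  true  c = refl
∧-not-∨ true  false c = refl

parity : ℕ → Bool
parity zero    = false
parity (suc n) = not (parity n)

parity-+ : ∀ m n → parity (m + n) ≡ parity m xor parity n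
parity-+ zero    n = refl
parity-+ (suc m) n = trans (cong not (parity-+ m n)) (not-distribˡ-xor (parity m) (parity n))

parity-double : ∀ n → parity (n + n) ≡ false
parity-double n = trans (parity-+ n n) (xor-same (parity n))

parity-double-+ : ∀ n m → parity (n + (n + m)) ≡ parity m
parity-double-+ n m = begin
  parity (n + (n + m))           ≡⟨ cong parity (+-assoc n n m) ⟨
  parity (n + n + m)             ≡⟨ parity-+ (n + n) m ⟩
  parity (n + n) xor parity m    ≡⟨ cong (_xor parity m) (parity-double n) ⟩
  parity m                       ∎
  where open ≡-Reasoning

%2≡parity : ∀ n → n % 2 ≡ [ parity n ]· 1
%2≡parity zero          = refl
%2≡parity (suc zero)    = refl
%2≡parity (suc (suc n)) = begin
  (2 + n) % 2                   ≡⟨ cong (_% 2) (+-comm 2 n) ⟩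
  (n + 2) % 2                   ≡⟨ [m+n]%n≡m%n n 2 ⟩
  n % 2                         ≡⟨ %2≡parity n ⟩
  [ parity n ]· 1               ≡⟨ cong ([_]· 1) (not-involutive (parity n)) ⟨
  [ not (not (parity n)) ]· 1   ∎
  where open ≡-Reasoning

[]·1-injective : ∀ {a b} → [ a ]· 1 ≡ [ b ]· 1 → a ≡ b
[]·1-injective {true}  {true}  _ = refl
[]·1-injective {false} {false} _ = refl

%2-≡⇒parity-≡ : ∀ m n → m % 2 ≡ n % 2 → parity m ≡ parity n
%2-≡⇒parity-≡ m n eq = []·1-injective (trans (sym (%2≡parity m)) (trans eq (%2≡parity n)))

parity-≡⇒%2-≡ : ∀ m n → parity m ≡ parity n → m % 2 ≡ n % 2
parity-≡⇒%2-≡ m n eq = trans (%2≡parity m) (trans (cong ([_]· 1) eq) (sym (%2≡parity n)))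

odd⇒1+double : ∀ n → parity n ≡ true → ∃ λ p → n ≡ suc (p + p)
odd⇒1+double (suc zero)    _   = 0 , refl
odd⇒1+double (suc (suc n)) odd with odd⇒1+double n (trans (sym (not-involutive (parity n))) odd)
... | p , refl = suc p , cong (suc ∘ suc) (sym (+-suc p p))

even⇒≢1 : ∀ n → parity n ≡ false → (1 ≡ᵇ n) ≡ false
even⇒≢1 zero          _  = refl
even⇒≢1 (suc zero)    ()
even⇒≢1 (suc (suc n)) _  = refl

even-sum⇒same-parity : ∀ m n → parity (m + n) ≡ false → parity m ≡ parity n
even-sum⇒same-parity m n even with parity m | parity n | trans (sym (parity-+ m n)) even
... | true  | true  | _  = refl
... | false | false | _  = refl
... | true  | false | ()
... | false | true  | ()

∑ : List A → (A → ℕ) → ℕ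
∑ []       f = 0
∑ (x ∷ xs) f = f x + ∑ xs f

infixr 5 ∑
syntax ∑ xs (λ x → e) = ∑[ x ∈ xs ] e

∑-cong : ∀ (xs : List A) {f g : A → ℕ} → (∀ x → x ∈ xs → f x ≡ g x) → ∑ xs f ≡ ∑ xs g
∑-cong []       eq = refl
∑-cong (x ∷ xs) eq = cong₂ _+_ (eq x (here refl)) (∑-cong xs (λ y y∈xs → eq y (there y∈xs)))

∑-parity-cong : ∀ (xs : List A) {f g : A → ℕ} → (∀ x → x ∈ xs → parity (f x) ≡ parity (g x)) →
                parity (∑ xs f) ≡ parity (∑ xs g)
∑-parity-cong []                eq = refl
∑-parity-cong (x ∷ xs) {f} {g}  eq = begin
  parity (f x + ∑ xs f)           ≡⟨ parity-+ (f x) (∑ xs f) ⟩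
  parity (f x) xor parity (∑ xs f) ≡⟨ cong₂ _xor_ (eq x (here refl)) (∑-parity-cong xs λ y y∈xs → eq y (there y∈xs)) ⟩
  parity (g x) xor parity (∑ xs g) ≡⟨ parity-+ (g x) (∑ xs g) ⟨
  parity (g x + ∑ xs g)           ∎
  where open ≡-Reasoning

∑-zero : ∀ (xs : List A) → ∑[ x ∈ xs ] 0 ≡ 0
∑-zero []       = refl
∑-zero (x ∷ xs) = ∑-zero xs

∑-even : ∀ (xs : List A) {f : A → ℕ} → (∀ x → x ∈ xs → parity (f x) ≡ false) → parity (∑ xs f) ≡ false
∑-even xs even = trans (∑-parity-cong xs {g = λ _ → 0} even) (cong parity (∑-zero xs))

∑-+ : ∀ (xs : List A) (f g : A → ℕ) → ∑[ x ∈ xs ] (f x + g x) ≡ ∑ xs f + ∑ xs g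
∑-+ []       f g = refl
∑-+ (x ∷ xs) f g = trans (cong (f x + g x +_) (∑-+ xs f g)) (interchange (f x) (g x) (∑ xs f) (∑ xs g))

∑-++ : ∀ (xs ys : List A) (f : A → ℕ) → ∑ (xs ++ ys) f ≡ ∑ xs f + ∑ ys f
∑-++ []       ys f = refl
∑-++ (x ∷ xs) ys f = trans (cong (f x +_) (∑-++ xs ys f)) (sym (+-assoc (f x) (∑ xs f) (∑ ys f)))

∑-map : ∀ (g : A → B) (xs : List A) (f : B → ℕ) → ∑ (map g xs) f ≡ ∑ xs (f ∘ g)
∑-map g []       f = refl
∑-map g (x ∷ xs) f = cong (f (g x) +_) (∑-map g xs f)

∑-concatMap : ∀ (g : A → List B) (xs : List A) (f : B → ℕ) → ∑ (concatMap g xs) f ≡ ∑[ x ∈ xs ] ∑ (g x) f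
∑-concatMap g []       f = refl
∑-concatMap g (x ∷ xs) f = trans (∑-++ (g x) (concat (map g xs)) f) (cong (∑ (g x) f +_) (∑-concatMap g xs f))

[]·-∑ : ∀ b (xs : List A) (f : A → ℕ) → [ b ]· ∑ xs f ≡ ∑[ x ∈ xs ] [ b ]· f x
[]·-∑ true  xs f = refl
[]·-∑ false xs f = sym (∑-zero xs)

∑-swap : ∀ (xs : List A) (ys : List B) (K : A → B → ℕ) → ∑[ x ∈ xs ] ∑ ys (K x) ≡ ∑[ y ∈ ys ] ∑[ x ∈ xs ] K x y
∑-swap []       ys K = sym (∑-zero ys)
∑-swap (x ∷ xs) ys K = trans (cong (∑ ys (K x) +_) (∑-swap xs ys K)) (sym (∑-+ ys (K x) λ y → ∑[ x ∈ xs ] K x y))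

∑-symmetric-even : (K : A → A → ℕ) → (∀ x y → K x y ≡ K y x) → (∀ x → K x x ≡ 0) →
                   ∀ xs → parity (∑[ x ∈ xs ] ∑ xs (K x)) ≡ false
∑-symmetric-even K K-sym K-diag []       = refl
∑-symmetric-even K K-sym K-diag (a ∷ xs) = begin
  parity (K a a + Sa + Rest)
    ≡⟨ cong (λ d → parity (d + Sa + Rest)) (K-diag a) ⟩
  parity (Sa + Rest)
    ≡⟨ cong (λ s → parity (Sa + s)) (∑-+ xs (λ x → K x a) (λ x → ∑ xs (K x))) ⟩
  parity (Sa + ((∑[ x ∈ xs ] K x a) + S))
    ≡⟨ cong (λ s → parity (Sa + (s + S))) (∑-cong xs (λ x _ → K-sym x a)) ⟩
  parity (Sa + (Sa + S))
    ≡⟨ parity-double-+ Sa S ⟩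
  parity S
    ≡⟨ ∑-symmetric-even K K-sym K-diag xs ⟩
  false ∎
  where
  open ≡-Reasoning
  Sa = ∑ xs (K a)
  S  = ∑[ x ∈ xs ] ∑ xs (K x)
  Rest = ∑[ x ∈ xs ] (K x a + ∑ xs (K x))

countᵇ-++ : ∀ (p : A → Bool) xs ys → countᵇ p (xs ++ ys) ≡ countᵇ p xs + countᵇ p ys
countᵇ-++ p []       ys = refl
countᵇ-++ p (x ∷ xs) ys with p x
... | true  = cong suc (countᵇ-++ p xs ys)
... | false = countᵇ-++ p xs ys

countᵇ-map : ∀ (p : B → Bool) (f : A → B) xs → countᵇ p (map f xs) ≡ countᵇ (p ∘ f) xs
countᵇ-map p f []       = refl
countᵇ-map p f (x ∷ xs) with p (f x)
... | true  = cong suc (countᵇ-map p f xs)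
... | false = countᵇ-map p f xs

countᵇ-cong : ∀ {p q : A → Bool} xs → (∀ x → p x ≡ q x) → countᵇ p xs ≡ countᵇ q xs
countᵇ-cong []               eq = refl
countᵇ-cong {q = q} (x ∷ xs) eq rewrite eq x with q x
... | true  = cong suc (countᵇ-cong xs eq)
... | false = countᵇ-cong xs eq

countᵇ-∧ : ∀ b (q : A → Bool) xs → countᵇ (λ x → b ∧ q x) xs ≡ [ b ]· countᵇ q xs
countᵇ-∧ true  q xs       = refl
countᵇ-∧ false q []       = refl
countᵇ-∧ false q (x ∷ xs) = countᵇ-∧ false q xs

allᵇ-cong : ∀ {p q : A → Bool} xs → (∀ x → p x ≡ q x) → allᵇ p xs ≡ allᵇ q xs
allᵇ-cong []       eq = refl
allᵇ-cong (x ∷ xs) eq = cong₂ _∧_ (eq x) (allᵇ-cong xs eq)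

allᵇ-∧ : ∀ (p q : A → Bool) xs → allᵇ (λ x → p x ∧ q x) xs ≡ allᵇ p xs ∧ allᵇ q xs
allᵇ-∧ p q []       = refl
allᵇ-∧ p q (x ∷ xs) rewrite allᵇ-∧ p q xs with p x | q x
... | true  | true  = refl
... | true  | false = sym (∧-zeroʳ (allᵇ p xs))
... | false | _     = refl

allᵇ-false : ∀ (p : A → Bool) {x} xs → x ∈ xs → p x ≡ false → allᵇ p xs ≡ false
allᵇ-false p (y ∷ xs) (here refl)  px = cong (_∧ allᵇ p xs) px
allᵇ-false p (y ∷ xs) (there x∈xs) px = trans (cong (p y ∧_) (allᵇ-false p xs x∈xs px)) (∧-zeroʳ (p y))

allᵇ-true : ∀ (p : A → Bool) xs → (∀ x → p x ≡ true) → allᵇ p xs ≡ true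
allᵇ-true p []       holds = refl
allᵇ-true p (x ∷ xs) holds rewrite holds x = allᵇ-true p xs holds

≡ᵇ-true⇒≡ : ∀ m n → (m ≡ᵇ n) ≡ true → m ≡ n
≡ᵇ-true⇒≡ m n eq = ≡ᵇ⇒≡ m n (subst T (sym eq) _)

≡ᵇ-refl : ∀ n → (n ≡ᵇ n) ≡ true
≡ᵇ-refl n = Equivalence.to T-≡ (≡⇒≡ᵇ n n refl)

≡ᵇ-sym : ∀ m n → (m ≡ᵇ n) ≡ (n ≡ᵇ m)
≡ᵇ-sym zero    zero    = refl
≡ᵇ-sym zero    (suc n) = refl
≡ᵇ-sym (suc m) zero    = refl
≡ᵇ-sym (suc m) (suc n) = ≡ᵇ-sym m n

≡ᵇ-suc : ∀ n → (n ≡ᵇ suc n) ≡ false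
≡ᵇ-suc zero    = refl
≡ᵇ-suc (suc n) = ≡ᵇ-suc n

==ᵛ⇒≡ : ∀ u w → (u ==ᵛ w) ≡ true → u ≡ w
==ᵛ⇒≡ (i , j) (k , l) eq with i ≡ᵇ k in i=k
... | true = cong₂ _,_ (≡ᵇ-true⇒≡ i k i=k) (≡ᵇ-true⇒≡ j l eq)

==ᵛ-refl : ∀ u → (u ==ᵛ u) ≡ true
==ᵛ-refl (i , j) = cong₂ _∧_ (≡ᵇ-refl i) (≡ᵇ-refl j)

==ᵛ-sym : ∀ u w → (u ==ᵛ w) ≡ (w ==ᵛ u)
==ᵛ-sym (i , j) (k , l) = cong₂ _∧_ (≡ᵇ-sym i k) (≡ᵇ-sym j l)

-- Perfect matchings of induced subgraphs

VertexSet : Set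
VertexSet = Vertex → Bool

remove : Vertex → VertexSet → VertexSet
remove v U x = U x ∧ not (x ==ᵛ v)

removeEnds : Edge → VertexSet → VertexSet
removeEnds e U x = U x ∧ not (incident x e)

insert : Vertex → VertexSet → VertexSet
insert v U x = (x ==ᵛ v) ∨ U x

other : Vertex → Edge → Vertex
other v (u , w) = if v ==ᵛ u then w else u

fullSet : VertexSet
fullSet _ = true

insert-remove₂ : ∀ v w → (v ==ᵛ w) ≡ false → ∀ y → insert v (remove w (remove v fullSet)) y ≡ remove w fullSet y
insert-remove₂ v w v≠w y with y ==ᵛ v in y=v
... | true rewrite ==ᵛ⇒≡ y v y=v | v≠w = refl
... | false = refl

remove-comm : ∀ a b U x → remove a (remove b U) x ≡ remove b (remove a U) x
remove-comm a b U x = xy∙z≈xz∙y (U x) (not (x ==ᵛ b)) (not (x ==ᵛ a))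

removeEnds-comm : ∀ e e′ U x → removeEnds e′ (removeEnds e U) x ≡ removeEnds e (removeEnds e′ U) x
removeEnds-comm e e′ U x = xy∙z≈xz∙y (U x) (not (incident x e)) (not (incident x e′))

remove-insert : ∀ v U → U v ≡ false → ∀ x → remove v (insert v U) x ≡ U x
remove-insert v U Uv x with x ==ᵛ v in x=v
... | true rewrite ==ᵛ⇒≡ x v x=v = sym Uv
... | false = ∧-identityʳ (U x)

module Matchings (Vs : List Vertex) where

  isPerfectMatching : VertexSet → List Edge → Bool
  isPerfectMatching U S = allᵇ (λ v → degree S v ≡ᵇ [ U v ]· 1) Vs

  pmCount : List Edge → VertexSet → ℕ
  pmCount E U = countᵇ (isPerfectMatching U) (subsets E)

  covers : VertexSet → Edge → Bool
  covers U e = allᵇ (λ x → not (incident x e) ∨ U x) Vs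

  pmCount-cong : ∀ E {U U′} → (∀ x → U x ≡ U′ x) → pmCount E U ≡ pmCount E U′
  pmCount-cong E eq = countᵇ-cong (subsets E) λ S → allᵇ-cong Vs λ v → cong (λ b → degree S v ≡ᵇ [ b ]· 1) (eq v)

  isPerfectMatching-∷ : ∀ U e S → isPerfectMatching U (e ∷ S) ≡ covers U e ∧ isPerfectMatching (removeEnds e U) S
  isPerfectMatching-∷ U e S = trans (allᵇ-cong Vs atVertex) (allᵇ-∧ _ _ Vs)
    where
    atVertex : ∀ x → (degree (e ∷ S) x ≡ᵇ [ U x ]· 1)
                   ≡ (not (incident x e) ∨ U x) ∧ (degree S x ≡ᵇ [ removeEnds e U x ]· 1)
    atVertex x with incident x e | U x
    ... | true  | true  = refl
    ... | true  | false = refl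
    ... | false | true  = refl
    ... | false | false = refl

  pmCount-∷ : ∀ e E U → pmCount (e ∷ E) U ≡ pmCount E U + [ covers U e ]· pmCount E (removeEnds e U)
  pmCount-∷ e E U = begin
    countᵇ (isPerfectMatching U) (subsets E ++ map (e ∷_) (subsets E))
      ≡⟨ countᵇ-++ (isPerfectMatching U) (subsets E) _ ⟩
    pmCount E U + countᵇ (isPerfectMatching U) (map (e ∷_) (subsets E))
      ≡⟨ cong (pmCount E U +_) (countᵇ-map (isPerfectMatching U) (e ∷_) (subsets E)) ⟩
    pmCount E U + countᵇ (isPerfectMatching U ∘ (e ∷_)) (subsets E)
      ≡⟨ cong (pmCount E U +_) (countᵇ-cong (subsets E) (isPerfectMatching-∷ U e)) ⟩
    pmCount E U + countᵇ (λ S → covers U e ∧ isPerfectMatching (removeEnds e U) S) (subsets E)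
      ≡⟨ cong (pmCount E U +_) (countᵇ-∧ (covers U e) _ (subsets E)) ⟩
    pmCount E U + [ covers U e ]· pmCount E (removeEnds e U) ∎
    where open ≡-Reasoning

  covers-outside : ∀ {v} e U → v ∈ Vs → incident v e ≡ true → U v ≡ false → covers U e ≡ false
  covers-outside e U v∈Vs v∈e Uv = allᵇ-false _ Vs v∈Vs (cong₂ (λ i b → not i ∨ b) v∈e Uv)

  pmCount-∷-uncovered : ∀ e E U → covers U e ≡ false → pmCount (e ∷ E) U ≡ pmCount E U
  pmCount-∷-uncovered e E U uncovered =
    trans (pmCount-∷ e E U) (trans (cong (λ b → pmCount E U + [ b ]· pmCount E (removeEnds e U)) uncovered) (+-identityʳ _))

  covers-removeEnds : ∀ U e e′ → covers U e ∧ covers (removeEnds e U) e′ ≡ covers U e′ ∧ covers (removeEnds e′ U) e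
  covers-removeEnds U e e′ = trans (sym (allᵇ-∧ _ _ Vs)) (trans (allᵇ-cong Vs atVertex) (allᵇ-∧ _ _ Vs))
    where
    atVertex : ∀ x → ((not (incident x e) ∨ U x) ∧ (not (incident x e′) ∨ removeEnds e U x))
                   ≡ ((not (incident x e′) ∨ U x) ∧ (not (incident x e) ∨ removeEnds e′ U x))
    atVertex x with incident x e | incident x e′ | U x
    ... | true  | true  | _     = refl
    ... | true  | false | true  = refl
    ... | true  | false | false = refl
    ... | false | true  | true  = refl
    ... | false | true  | false = refl
    ... | false | false | true  = refl
    ... | false | false | false = refl

  expansion : Vertex → List Edge → VertexSet → ℕ
  expansion v E U = ∑[ e ∈ E ] [ incident v e ∧ covers U e ]· pmCount E (removeEnds e U)

  expansion-∷-incident : ∀ {v} e E U → v ∈ Vs → incident v e ≡ true →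
                         pmCount E U ≡ expansion v E U → pmCount (e ∷ E) U ≡ expansion v (e ∷ E) U
  expansion-∷-incident {v} e E U v∈Vs v∈e expandE = begin
    pmCount (e ∷ E) U
      ≡⟨ pmCount-∷ e E U ⟩
    pmCount E U + [ covers U e ]· pmCount E (removeEnds e U)
      ≡⟨ +-comm (pmCount E U) _ ⟩
    [ covers U e ]· pmCount E (removeEnds e U) + pmCount E U
      ≡⟨ cong₂ _+_ (cong ([ covers U e ]·_) (sym (pmCount-∷-removeEnds e v∈e)))
                   (trans expandE (∑-cong E λ e′ _ → []·-cong (incident v e′ ∧ covers U e′)
                      λ guard → sym (pmCount-∷-removeEnds e′ (∧-conicalˡ _ _ guard)))) ⟩
    [ covers U e ]· pmCount (e ∷ E) (removeEnds e U) + Rest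
      ≡⟨ cong (λ b → [ b ∧ covers U e ]· pmCount (e ∷ E) (removeEnds e U) + Rest) v∈e ⟨
    expansion v (e ∷ E) U ∎
    where
    Rest = ∑[ e′ ∈ E ] [ incident v e′ ∧ covers U e′ ]· pmCount (e ∷ E) (removeEnds e′ U)
    open ≡-Reasoning
    pmCount-∷-removeEnds : ∀ e′ → incident v e′ ≡ true → pmCount (e ∷ E) (removeEnds e′ U) ≡ pmCount E (removeEnds e′ U)
    pmCount-∷-removeEnds e′ v∈e′ = pmCount-∷-uncovered e E (removeEnds e′ U)
      (covers-outside e (removeEnds e′ U) v∈Vs v∈e (trans (cong (λ i → U v ∧ not i) v∈e′) (∧-zeroʳ (U v))))

  expansion-∷-away : ∀ {v} e E U → incident v e ≡ false → U v ≡ true →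
                     (∀ U′ → U′ v ≡ true → pmCount E U′ ≡ expansion v E U′) →
                     pmCount (e ∷ E) U ≡ expansion v (e ∷ E) U
  expansion-∷-away {v} e E U v∉e Uv expandE = begin
    pmCount (e ∷ E) U
      ≡⟨ pmCount-∷ e E U ⟩
    pmCount E U + [ covers U e ]· pmCount E (removeEnds e U)
      ≡⟨ cong₂ _+_ (expandE U Uv) (cong ([ covers U e ]·_) (expandE (removeEnds e U) v∈U∖e)) ⟩
    ∑ E Keep + [ covers U e ]· expansion v E (removeEnds e U)
      ≡⟨ cong (∑ E Keep +_) (trans ([]·-∑ (covers U e) E _) (∑-cong E λ e′ _ → useFirst e′)) ⟩
    ∑ E Keep + ∑ E Use
      ≡⟨ ∑-+ E Keep Use ⟨
    (∑[ e′ ∈ E ] (Keep e′ + Use e′))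
      ≡⟨ ∑-cong E (λ e′ _ → trans (cong ([ incident v e′ ∧ covers U e′ ]·_) (pmCount-∷ e E (removeEnds e′ U)))
                                   ([]·-+ (incident v e′ ∧ covers U e′) _ _)) ⟨
    (∑[ e′ ∈ E ] [ incident v e′ ∧ covers U e′ ]· pmCount (e ∷ E) (removeEnds e′ U))
      ≡⟨ cong (λ b → [ b ∧ covers U e ]· pmCount (e ∷ E) (removeEnds e U)
                       + (∑[ e′ ∈ E ] [ incident v e′ ∧ covers U e′ ]· pmCount (e ∷ E) (removeEnds e′ U))) v∉e ⟨
    expansion v (e ∷ E) U ∎
    where
    open ≡-Reasoning
    v∈U∖e : removeEnds e U v ≡ true
    v∈U∖e = trans (cong (λ i → U v ∧ not i) v∉e) (trans (∧-identityʳ (U v)) Uv)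
    Keep Use : Edge → ℕ
    Keep e′ = [ incident v e′ ∧ covers U e′ ]· pmCount E (removeEnds e′ U)
    Use  e′ = [ incident v e′ ∧ covers U e′ ]· [ covers (removeEnds e′ U) e ]· pmCount E (removeEnds e (removeEnds e′ U))
    useFirst : ∀ e′ → [ covers U e ]· [ incident v e′ ∧ covers (removeEnds e U) e′ ]·
                        pmCount E (removeEnds e′ (removeEnds e U))
                    ≡ Use e′
    useFirst e′ =
      trans ([]·-exchange (covers U e) (covers (removeEnds e U) e′) (covers U e′) _ (incident v e′) _
                          (covers-removeEnds U e e′))
            (cong (λ n → [ incident v e′ ∧ covers U e′ ]· [ covers (removeEnds e′ U) e ]· n)
                  (pmCount-cong E (removeEnds-comm e e′ U)))

  pmCount-expand : ∀ {v} E U → v ∈ Vs → U v ≡ true → pmCount E U ≡ expansion v E U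
  pmCount-expand []       U v∈Vs Uv = cong ([_]· 1) (allᵇ-false _ Vs v∈Vs (cong (λ b → 0 ≡ᵇ [ b ]· 1) Uv))
  pmCount-expand {v} (e ∷ E) U v∈Vs Uv = byIncidence (incident v e) refl
    where
    byIncidence : ∀ b → incident v e ≡ b → pmCount (e ∷ E) U ≡ expansion v (e ∷ E) U
    byIncidence true  v∈e = expansion-∷-incident e E U v∈Vs v∈e (pmCount-expand E U v∈Vs Uv)
    byIncidence false v∉e = expansion-∷-away e E U v∉e Uv (λ U′ → pmCount-expand E U′ v∈Vs)

  Proper : Edge → Set
  Proper (u , w) = u ∈ Vs × w ∈ Vs × (u ==ᵛ w) ≡ false

  covers-proper : ∀ U {u w} → u ∈ Vs → w ∈ Vs → covers U (u , w) ≡ U u ∧ U w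
  covers-proper U {u} {w} u∈Vs w∈Vs with U u in Uu | U w in Uw
  ... | false | _     = covers-outside (u , w) U u∈Vs (cong (_∨ (u ==ᵛ w)) (==ᵛ-refl u)) Uu
  ... | true  | false = covers-outside (u , w) U w∈Vs (trans (cong ((w ==ᵛ u) ∨_) (==ᵛ-refl w)) (∨-zeroʳ _)) Uw
  ... | true  | true  = allᵇ-true _ Vs inside
    where
    inside : ∀ x → not (incident x (u , w)) ∨ U x ≡ true
    inside x with x ==ᵛ u in x=u
    ... | true rewrite ==ᵛ⇒≡ x u x=u = Uu
    ... | false with x ==ᵛ w in x=w
    ...   | true rewrite ==ᵛ⇒≡ x w x=w = Uw
    ...   | false = refl

  module _ (E : List Edge) (proper : ∀ e → e ∈ E → Proper e) where

    other-≢ : ∀ v e → e ∈ E → incident v e ≡ true → (v ==ᵛ other v e) ≡ false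
    other-≢ v (u , w) e∈E v∈e with v ==ᵛ u in v=u
    ... | true rewrite ==ᵛ⇒≡ v u v=u = proj₂ (proj₂ (proper (u , w) e∈E))
    ... | false = v=u

    pmCount-expand-other : ∀ {v} U → v ∈ Vs → U v ≡ true →
      pmCount E U ≡ ∑[ e ∈ E ] [ incident v e ∧ U (other v e) ]· pmCount E (remove (other v e) (remove v U))
    pmCount-expand-other {v} U v∈Vs Uv = trans (pmCount-expand E U v∈Vs Uv) (∑-cong E λ e e∈E → term e (proper e e∈E))
      where
      term : ∀ e → Proper e → [ incident v e ∧ covers U e ]· pmCount E (removeEnds e U)
                            ≡ [ incident v e ∧ U (other v e) ]· pmCount E (remove (other v e) (remove v U))
      term (u , w) (u∈Vs , w∈Vs , _) with v ==ᵛ u in v=u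
      ... | true rewrite ==ᵛ⇒≡ v u v=u | covers-proper U u∈Vs w∈Vs | Uv =
        cong ([ U w ]·_) (pmCount-cong E λ x → ∧-not-∨ (U x) (x ==ᵛ u) (x ==ᵛ w))
      ... | false with v ==ᵛ w in v=w
      ...   | false = refl
      ...   | true rewrite ==ᵛ⇒≡ v w v=w | covers-proper U u∈Vs w∈Vs | Uv | ∧-identityʳ (U u) =
        cong ([ U u ]·_) (pmCount-cong E λ x → trans (cong (λ b → U x ∧ not b) (∨-comm (x ==ᵛ u) (x ==ᵛ w)))
                                                     (∧-not-∨ (U x) (x ==ᵛ w) (x ==ᵛ u)))

    ∑-pmCount-removeNeighbour-even : ∀ {v} U → v ∈ Vs → U v ≡ true →
      parity (∑[ e ∈ E ] [ incident v e ∧ U (other v e) ]· pmCount E (remove (other v e) U)) ≡ false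
    ∑-pmCount-removeNeighbour-even {v} U v∈Vs Uv = trans (cong parity (∑-cong E expandEach)) (∑-symmetric-even K K-sym K-diag E)
      where
      guard : Edge → Bool
      guard e = incident v e ∧ U (other v e)
      K : Edge → Edge → ℕ
      K e e′ = [ guard e ]· [ incident v e′ ∧ remove (other v e) U (other v e′) ]·
               pmCount E (remove (other v e′) (remove v (remove (other v e) U)))
      expandEach : ∀ e → e ∈ E → [ guard e ]· pmCount E (remove (other v e) U) ≡ ∑ E (K e)
      expandEach e e∈E = trans ([]·-cong (guard e) λ g → pmCount-expand-other (remove (other v e) U) v∈Vs
                                  (cong₂ (λ a b → a ∧ not b) Uv (other-≢ v e e∈E (∧-conicalˡ _ _ g))))
                               ([]·-∑ (guard e) E _)
      K-sym : ∀ e e′ → K e e′ ≡ K e′ e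
      K-sym e e′ = trans ([]·-guard-swap (incident v e) (U o) (incident v e′) (U o′) (not (o′ ==ᵛ o)) _)
                         (cong₂ (λ b n → [ guard e′ ]· [ incident v e ∧ (U o ∧ not b) ]· n)
                                (==ᵛ-sym o′ o) (pmCount-cong E removeAll-comm))
        where
        o o′ : Vertex
        o  = other v e
        o′ = other v e′
        removeAll-comm : ∀ x → remove o′ (remove v (remove o U)) x ≡ remove o (remove v (remove o′ U)) x
        removeAll-comm x = trans (remove-comm o′ v (remove o U) x)
                           (trans (cong (_∧ not (x ==ᵛ v)) (remove-comm o′ o U x)) (remove-comm v o (remove o′ U) x))
      K-diag : ∀ e → K e e ≡ 0
      K-diag e = trans (cong (λ b → [ guard e ]· [ b ]· pmCount E (remove o (remove v (remove o U)))) excluded) ([]·-zero (guard e))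
        where
        o = other v e
        excluded : incident v e ∧ (U o ∧ not (o ==ᵛ o)) ≡ false
        excluded = trans (cong (λ b → incident v e ∧ (U o ∧ not b)) (==ᵛ-refl o))
                         (trans (cong (incident v e ∧_) (∧-zeroʳ (U o))) (∧-zeroʳ (incident v e)))

    -- Equivalently (take g an indicator function): every vertex has an even number of
    -- neighbours in W, counted with multiplicity.
    EvenNeighbourhoods : (Vertex → Bool) → Set
    EvenNeighbourhoods W = ∀ (g : Vertex → ℕ) →
      parity (∑[ x ∈ Vs ] [ W x ]· (∑[ e ∈ E ] [ incident x e ]· g (other x e))) ≡ false

    ∑-pmCount-insert-even : ∀ {W} → EvenNeighbourhoods W → ∀ U →
      (∀ e → e ∈ E → ∀ x → W x ≡ true → incident x e ≡ true → U (other x e) ≡ true) →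
      parity (∑[ x ∈ Vs ] [ W x ∧ not (U x) ]· pmCount E (insert x U)) ≡ false
    ∑-pmCount-insert-even {W} evenNbs U nbrs⊆U =
      trans (∑-parity-cong Vs termwise) (evenNbs λ b → pmCount E (remove b U))
      where
      termwise : ∀ x → x ∈ Vs → parity ([ W x ∧ not (U x) ]· pmCount E (insert x U))
                              ≡ parity ([ W x ]· (∑[ e ∈ E ] [ incident x e ]· pmCount E (remove (other x e) U)))
      termwise x x∈Vs with W x in Wx | U x in Ux
      ... | false | _    = refl
      ... | true  | true = sym (trans (cong parity (∑-cong E neighbourInU)) (∑-pmCount-removeNeighbour-even U x∈Vs Ux))
        where
        neighbourInU : ∀ e → e ∈ E → [ incident x e ]· pmCount E (remove (other x e) U)
                                   ≡ [ incident x e ∧ U (other x e) ]· pmCount E (remove (other x e) U)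
        neighbourInU e e∈E with incident x e in x∈e
        ... | false = refl
        ... | true rewrite nbrs⊆U e e∈E x Wx x∈e = refl
      ... | true  | false = cong parity (trans (pmCount-expand-other (insert x U) x∈Vs x∈insert) (∑-cong E matchX))
        where
        x∈insert : insert x U x ≡ true
        x∈insert = cong (_∨ U x) (==ᵛ-refl x)
        matchX : ∀ e → e ∈ E → [ incident x e ∧ insert x U (other x e) ]· pmCount E (remove (other x e) (remove x (insert x U)))
                             ≡ [ incident x e ]· pmCount E (remove (other x e) U)
        matchX e e∈E with incident x e in x∈e
        ... | false = refl
        ... | true rewrite nbrs⊆U e e∈E x Wx x∈e | ∨-zeroʳ (other x e ==ᵛ x) =
          pmCount-cong E λ y → cong (_∧ not (y ==ᵛ other x e)) (remove-insert x U Ux y)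

-- Grid coordinates

range1-suc : ∀ n → range1 (suc n) ≡ 1 ∷ map suc (range1 n)
range1-suc n = cong (λ l → 1 ∷ map suc l) (sym (map-applyUpTo id suc n))

∑-range1-suc : ∀ n (f : ℕ → ℕ) → ∑ (range1 (suc n)) f ≡ f 1 + ∑ (range1 n) (f ∘ suc)
∑-range1-suc n f = trans (cong (λ l → ∑ l f) (range1-suc n)) (cong (f 1 +_) (∑-map suc (range1 n) f))

∑-range1-paired-even : ∀ q (F : ℕ → ℕ) → (∀ m → parity m ≡ false → F (suc m) ≡ F (suc (suc m))) →
                       parity (∑ (range1 (q + q)) F) ≡ false
∑-range1-paired-even zero    F paired = refl
∑-range1-paired-even (suc q) F paired = begin
  parity (∑ (range1 (suc q + suc q)) F)                  ≡⟨ cong (λ n → parity (∑ (range1 (suc n)) F)) (+-suc q q) ⟩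
  parity (∑ (range1 (2 + (q + q))) F)                    ≡⟨ cong parity (∑-range1-suc (suc (q + q)) F) ⟩
  parity (F 1 + ∑ (range1 (suc (q + q))) (F ∘ suc))      ≡⟨ cong (λ s → parity (F 1 + s)) (∑-range1-suc (q + q) (F ∘ suc)) ⟩
  parity (F 1 + (F 2 + ∑ R (F ∘ suc ∘ suc)))             ≡⟨ cong (λ n → parity (n + (F 2 + ∑ R (F ∘ suc ∘ suc)))) (paired 0 refl) ⟩
  parity (F 2 + (F 2 + ∑ R (F ∘ suc ∘ suc)))             ≡⟨ parity-double-+ (F 2) _ ⟩
  parity (∑ R (F ∘ suc ∘ suc))                           ≡⟨ ∑-range1-paired-even q (F ∘ suc ∘ suc) paired-shift ⟩
  false                                                  ∎
  where
  open ≡-Reasoning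
  R = range1 (q + q)
  paired-shift : ∀ m → parity m ≡ false → F (3 + m) ≡ F (4 + m)
  paired-shift m even = paired (2 + m) (trans (not-involutive (parity m)) even)

InRange : ℕ → ℕ → Set
InRange n j = 1 ≤ j × j ≤ n

InGrid : ℕ → ℕ → Vertex → Set
InGrid r c (i , j) = InRange r i × InRange c j

range1-bounds : ∀ n {j} → j ∈ range1 n → InRange n j
range1-bounds n j∈ with k , k∈ , refl ← ∈-map⁻ suc j∈ = s≤s z≤n , ∈-upTo⁻ k∈

∈-range1 : ∀ n {j} → InRange n j → j ∈ range1 n
∈-range1 n {suc k} (_ , k<n) = ∈-map⁺ suc (∈-upTo⁺ k<n)

∑-range1-point : ∀ n {j₀} k → InRange n j₀ → ∑[ j ∈ range1 n ] [ j ≡ᵇ j₀ ]· k ≡ k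
∑-range1-point (suc n) {suc zero}    k _             = begin
  (∑[ j ∈ range1 (suc n) ] [ j ≡ᵇ 1 ]· k) ≡⟨ ∑-range1-suc n (λ j → [ j ≡ᵇ 1 ]· k) ⟩
  k + (∑[ j ∈ range1 n ] [ j ≡ᵇ 0 ]· k)   ≡⟨ cong (k +_) (trans (∑-map suc (upTo n) _) (∑-zero (upTo n))) ⟩
  k + 0                                   ≡⟨ +-identityʳ k ⟩
  k                                       ∎
  where open ≡-Reasoning
∑-range1-point (suc n) {suc (suc j)} k (_ , s≤s j<n) =
  trans (∑-range1-suc n (λ j′ → [ j′ ≡ᵇ suc (suc j) ]· k)) (∑-range1-point n k (s≤s z≤n , j<n))

∈-gridVertices : ∀ r c {v} → InGrid r c v → v ∈ gridVertices r c
∈-gridVertices r c {i , j} (i∈ , j∈) =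
  ∈-concatMap⁺ (λ i → map (i ,_) (range1 c)) (Any.map (λ { refl → ∈-map⁺ (i ,_) (∈-range1 c j∈) }) (∈-range1 r i∈))

∑-gridVertices-point : ∀ r c {v} k → InGrid r c v → ∑[ x ∈ gridVertices r c ] [ x ==ᵛ v ]· k ≡ k
∑-gridVertices-point r c {i₀ , j₀} k (i∈ , j∈) = begin
  (∑[ x ∈ gridVertices r c ] [ x ==ᵛ (i₀ , j₀) ]· k)
    ≡⟨ ∑-concatMap (λ i → map (i ,_) (range1 c)) (range1 r) _ ⟩
  (∑[ i ∈ range1 r ] ∑[ x ∈ map (i ,_) (range1 c) ] [ x ==ᵛ (i₀ , j₀) ]· k)
    ≡⟨ ∑-cong (range1 r) (λ i _ → row i) ⟩
  (∑[ i ∈ range1 r ] [ i ≡ᵇ i₀ ]· (∑[ j ∈ range1 c ] [ j ≡ᵇ j₀ ]· k))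
    ≡⟨ ∑-cong (range1 r) (λ i _ → cong ([ i ≡ᵇ i₀ ]·_) (∑-range1-point c k j∈)) ⟩
  (∑[ i ∈ range1 r ] [ i ≡ᵇ i₀ ]· k)
    ≡⟨ ∑-range1-point r k i∈ ⟩
  k ∎
  where
  open ≡-Reasoning
  row : ∀ i → ∑[ x ∈ map (i ,_) (range1 c) ] [ x ==ᵛ (i₀ , j₀) ]· k
            ≡ [ i ≡ᵇ i₀ ]· (∑[ j ∈ range1 c ] [ j ≡ᵇ j₀ ]· k)
  row i = trans (∑-map (i ,_) (range1 c) _)
         (trans (∑-cong (range1 c) λ j _ → []·-∧ (i ≡ᵇ i₀) (j ≡ᵇ j₀) k) (sym ([]·-∑ (i ≡ᵇ i₀) (range1 c) _)))

∈-concatMap-range1⁻ : ∀ (f : ℕ → ℕ → A) n m {x} → x ∈ concatMap (λ i → map (f i) (range1 m)) (range1 n) →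
                      ∃ λ i → ∃ λ j → InRange n i × InRange m j × x ≡ f i j
∈-concatMap-range1⁻ f n m x∈ with find (∈-concatMap⁻ (λ i → map (f i) (range1 m)) x∈)
... | i , i∈ , x∈row with ∈-map⁻ (f i) x∈row
...   | j , j∈ , refl = i , j , range1-bounds n i∈ , range1-bounds m j∈ , refl

-- Colours and the odd × odd grid

oddWhite : Vertex → Bool
oddWhite (i , j) = parity i ∧ parity j

black : Vertex → Bool
black (i , j) = parity i xor parity j

oddWhite⇒white : ∀ v → oddWhite v ≡ true → black v ≡ false
oddWhite⇒white (i , j) ow with parity i | parity j
oddWhite⇒white (i , j) () | false | _
oddWhite⇒white (i , j) () | true  | false
... | true | true = refl

black-white-≢ : ∀ u v → black u ≡ true → black v ≡ false → (u ==ᵛ v) ≡ false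
black-white-≢ u v bu wv with u ==ᵛ v in u=v
... | false = refl
... | true rewrite ==ᵛ⇒≡ u v u=v = trans (sym bu) wv

rightEdge downEdge : ℕ → ℕ → Edge
rightEdge i j = (i , j) , (i , suc j)
downEdge  i j = (i , j) , (suc i , j)

edgeWeight : (Vertex → ℕ) → Edge → ℕ
edgeWeight g (u , w) = [ oddWhite u ]· g w + [ oddWhite w ]· g u

horizontal-paired : ∀ g i m → parity m ≡ false →
                    edgeWeight g ((i , 1 + m) , (i , 2 + m)) ≡ edgeWeight g ((i , 2 + m) , (i , 3 + m))
horizontal-paired g i m even rewrite even with parity i
... | true  = +-comm (g (i , 2 + m)) 0
... | false = refl

vertical-paired : ∀ g j m → parity m ≡ false →
                  edgeWeight g ((1 + m , j) , (2 + m , j)) ≡ edgeWeight g ((2 + m , j) , (3 + m , j))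
vertical-paired g j m even rewrite even = +-comm ([ parity j ]· g (2 + m , j)) 0

module OddGrid (p q : ℕ) where

  r c : ℕ
  r = suc (p + p)
  c = suc (q + q)

  Vs : List Vertex
  Vs = gridVertices r c

  horizontalEdges verticalEdges E : List Edge
  horizontalEdges = concatMap (λ i → map (rightEdge i) (range1 (q + q))) (range1 r)
  verticalEdges   = concatMap (λ i → map (downEdge i) (range1 c)) (range1 (p + p))
  E = gridEdges r c

  open Matchings Vs

  data GridEdge : Edge → Set where
    horizontal : ∀ {i j} → InRange r i → InRange (q + q) j → GridEdge ((i , j) , (i , suc j))
    vertical   : ∀ {i j} → InRange (p + p) i → InRange c j → GridEdge ((i , j) , (suc i , j))

  ∈gridEdges⇒GridEdge : ∀ {e} → e ∈ E → GridEdge e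
  ∈gridEdges⇒GridEdge e∈E with ∈-++⁻ horizontalEdges e∈E
  ... | inj₁ e∈H with _ , _ , i∈ , j∈ , refl ← ∈-concatMap-range1⁻ rightEdge r (q + q) e∈H = horizontal i∈ j∈
  ... | inj₂ e∈V with _ , _ , i∈ , j∈ , refl ← ∈-concatMap-range1⁻ downEdge (p + p) c e∈V  = vertical i∈ j∈

  gridEdge-ends : ∀ {u w} → GridEdge (u , w) → InGrid r c u × InGrid r c w
  gridEdge-ends (horizontal i∈ (1≤j , j≤)) = (i∈ , (1≤j , m≤n⇒m≤1+n j≤)) , (i∈ , (s≤s z≤n , s≤s j≤))
  gridEdge-ends (vertical (1≤i , i≤) j∈)   = ((1≤i , m≤n⇒m≤1+n i≤) , j∈) , ((s≤s z≤n , s≤s i≤) , j∈)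

  gridEdge-distinct : ∀ {u w} → GridEdge (u , w) → (u ==ᵛ w) ≡ false
  gridEdge-distinct (horizontal {i} {j} _ _) = trans (cong (_∧ (j ≡ᵇ suc j)) (≡ᵇ-refl i)) (≡ᵇ-suc j)
  gridEdge-distinct (vertical   {i} {j} _ _) = cong (_∧ (j ≡ᵇ j)) (≡ᵇ-suc i)

  gridEdge-colours : ∀ {u w} → GridEdge (u , w) → black w ≡ not (black u)
  gridEdge-colours (horizontal {i} {j} _ _) = sym (not-distribʳ-xor (parity i) (parity j))
  gridEdge-colours (vertical   {i} {j} _ _) = sym (not-distribˡ-xor (parity i) (parity j))

  gridProper : ∀ e → e ∈ E → Proper e
  gridProper (u , w) e∈E = ∈-gridVertices r c u∈ , ∈-gridVertices r c w∈ , gridEdge-distinct ge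
    where
    ge = ∈gridEdges⇒GridEdge e∈E
    u∈ = proj₁ (gridEdge-ends ge)
    w∈ = proj₂ (gridEdge-ends ge)

  other-black : ∀ e → e ∈ E → ∀ x → oddWhite x ≡ true → incident x e ≡ true → black (other x e) ≡ true
  other-black (u , w) e∈E x ow x∈e with gridEdge-colours (∈gridEdges⇒GridEdge e∈E) | x ==ᵛ u in x=u
  ... | colours | true  rewrite ==ᵛ⇒≡ x u x=u = trans colours (cong not (oddWhite⇒white u ow))
  ... | colours | false rewrite ==ᵛ⇒≡ x w x∈e =
    trans (sym (not-involutive (black u))) (cong not (trans (sym colours) (oddWhite⇒white w ow)))

  -- Along a row or column, the two edges at a vertex whose coordinate there is even have equal weight.
  ∑-edgeWeight-even : ∀ g → parity (∑ E (edgeWeight g)) ≡ false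
  ∑-edgeWeight-even g = begin
    parity (∑ (H ++ V) (edgeWeight g))                            ≡⟨ cong parity (∑-++ H V (edgeWeight g)) ⟩
    parity (∑ H (edgeWeight g) + ∑ V (edgeWeight g))              ≡⟨ parity-+ (∑ H (edgeWeight g)) _ ⟩
    parity (∑ H (edgeWeight g)) xor parity (∑ V (edgeWeight g))   ≡⟨ cong₂ _xor_ rows columns ⟩
    false                                                         ∎
    where
    open ≡-Reasoning
    H V : List Edge
    H = horizontalEdges
    V = verticalEdges
    row : ℕ → ℕ
    row i = ∑ (map (rightEdge i) (range1 (q + q))) (edgeWeight g)
    row-even : ∀ i → i ∈ range1 r → parity (row i) ≡ false
    row-even i _ = trans (cong parity (∑-map (rightEdge i) (range1 (q + q)) (edgeWeight g)))
                         (∑-range1-paired-even q (edgeWeight g ∘ rightEdge i) (horizontal-paired g i))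
    rows : parity (∑ H (edgeWeight g)) ≡ false
    rows = trans (cong parity (∑-concatMap (λ i → map (rightEdge i) (range1 (q + q))) (range1 r) (edgeWeight g)))
                 (∑-even (range1 r) {row} row-even)
    column : ℕ → ℕ
    column i = ∑ (range1 c) (edgeWeight g ∘ downEdge i)
    columns : parity (∑ V (edgeWeight g)) ≡ false
    columns = trans (cong parity (trans (∑-concatMap (λ i → map (downEdge i) (range1 c)) (range1 (p + p)) (edgeWeight g))
                                        (∑-cong (range1 (p + p)) λ i _ → ∑-map (downEdge i) (range1 c) (edgeWeight g))))
                    (∑-range1-paired-even p column λ m even → ∑-cong (range1 c) λ j _ → vertical-paired g j m even)

  ∑-oddWhite-incident : ∀ g {u w} → InGrid r c u → InGrid r c w → (u ==ᵛ w) ≡ false →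
    ∑[ x ∈ Vs ] [ oddWhite x ]· [ incident x (u , w) ]· g (other x (u , w)) ≡ edgeWeight g (u , w)
  ∑-oddWhite-incident g {u} {w} u∈ w∈ u≠w =
    trans (∑-cong Vs λ x _ → atVertex x)
          (trans (∑-+ Vs (λ x → [ x ==ᵛ u ]· [ oddWhite u ]· g w) (λ x → [ x ==ᵛ w ]· [ oddWhite w ]· g u))
                 (cong₂ _+_ (∑-gridVertices-point r c _ u∈) (∑-gridVertices-point r c _ w∈)))
    where
    atVertex : ∀ x → [ oddWhite x ]· [ incident x (u , w) ]· g (other x (u , w))
                   ≡ [ x ==ᵛ u ]· [ oddWhite u ]· g w + [ x ==ᵛ w ]· [ oddWhite w ]· g u
    atVertex x with x ==ᵛ u in x=u
    ... | true rewrite ==ᵛ⇒≡ x u x=u | u≠w = sym (+-identityʳ _)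
    ... | false with x ==ᵛ w in x=w
    ...   | true rewrite ==ᵛ⇒≡ x w x=w = refl
    ...   | false = []·-zero (oddWhite x)

  oddWhite-evenNeighbourhoods : EvenNeighbourhoods E gridProper oddWhite
  oddWhite-evenNeighbourhoods g = begin
    parity (∑[ x ∈ Vs ] [ oddWhite x ]· (∑[ e ∈ E ] [ incident x e ]· g (other x e)))
      ≡⟨ cong parity (∑-cong Vs λ x _ → []·-∑ (oddWhite x) E _) ⟩
    parity (∑[ x ∈ Vs ] ∑[ e ∈ E ] [ oddWhite x ]· [ incident x e ]· g (other x e))
      ≡⟨ cong parity (∑-swap Vs E _) ⟩
    parity (∑[ e ∈ E ] ∑[ x ∈ Vs ] [ oddWhite x ]· [ incident x e ]· g (other x e))
      ≡⟨ cong parity (∑-cong E λ _ e∈E → edgeTerm e∈E) ⟩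
    parity (∑ E (edgeWeight g))
      ≡⟨ ∑-edgeWeight-even g ⟩
    false ∎
    where
    open ≡-Reasoning
    edgeTerm : ∀ {u w} → (u , w) ∈ E →
               ∑[ x ∈ Vs ] [ oddWhite x ]· [ incident x (u , w) ]· g (other x (u , w)) ≡ edgeWeight g (u , w)
    edgeTerm e∈E = let ge = ∈gridEdges⇒GridEdge e∈E in
      ∑-oddWhite-incident g (proj₁ (gridEdge-ends ge)) (proj₂ (gridEdge-ends ge)) (gridEdge-distinct ge)

  a≡pmCount : ∀ h → a r c h ≡ pmCount E (remove h fullSet)
  a≡pmCount h = countᵇ-cong (subsets E) λ S → allᵇ-cong Vs λ v → cong (degree S v ≡ᵇ_) (holeDegree (v ==ᵛ h))
    where
    holeDegree : ∀ b → (if b then 0 else 1) ≡ [ not b ]· 1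
    holeDegree true  = refl
    holeDegree false = refl

  whiteHolePair-even : ∀ {h₁ h₂} → InGrid r c h₁ → InGrid r c h₂ → black h₁ ≡ false → black h₂ ≡ false →
    (h₁ ==ᵛ h₂) ≡ false → parity ([ oddWhite h₁ ]· a r c h₂ + [ oddWhite h₂ ]· a r c h₁) ≡ false
  whiteHolePair-even {h₁} {h₂} h₁∈ h₂∈ white₁ white₂ h₁≠h₂ =
    trans (cong parity (sym ∑≡holes)) (∑-pmCount-insert-even E gridProper oddWhite-evenNeighbourhoods U neighbours∈U)
    where
    U : VertexSet
    U = remove h₂ (remove h₁ fullSet)
    neighbours∈U : ∀ e → e ∈ E → ∀ x → oddWhite x ≡ true → incident x e ≡ true → U (other x e) ≡ true
    neighbours∈U e e∈E x ow x∈e = cong₂ (λ b₁ b₂ → not b₁ ∧ not b₂)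
      (black-white-≢ (other x e) h₁ (other-black e e∈E x ow x∈e) white₁)
      (black-white-≢ (other x e) h₂ (other-black e e∈E x ow x∈e) white₂)
    atVertex : ∀ x → [ oddWhite x ∧ not (U x) ]· pmCount E (insert x U)
                   ≡ [ x ==ᵛ h₁ ]· [ oddWhite h₁ ]· a r c h₂ + [ x ==ᵛ h₂ ]· [ oddWhite h₂ ]· a r c h₁
    atVertex x with x ==ᵛ h₁ in x=h₁
    ... | true rewrite ==ᵛ⇒≡ x h₁ x=h₁ | h₁≠h₂ =
      trans (cong₂ [_]·_ (∧-identityʳ (oddWhite h₁))
                         (trans (pmCount-cong E (insert-remove₂ h₁ h₂ h₁≠h₂)) (sym (a≡pmCount h₂))))
            (sym (+-identityʳ _))
    ... | false with x ==ᵛ h₂ in x=h₂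
    ...   | true rewrite ==ᵛ⇒≡ x h₂ x=h₂ =
      cong₂ [_]·_ (∧-identityʳ (oddWhite h₂))
                  (trans (pmCount-cong E λ y → trans (cong ((y ==ᵛ h₂) ∨_) (remove-comm h₂ h₁ fullSet y))
                                                     (insert-remove₂ h₂ h₁ (trans (==ᵛ-sym h₂ h₁) h₁≠h₂) y))
                         (sym (a≡pmCount h₁)))
    ...   | false = cong ([_]· pmCount E (insert x U)) (∧-zeroʳ (oddWhite x))
    ∑≡holes : ∑[ x ∈ Vs ] [ oddWhite x ∧ not (U x) ]· pmCount E (insert x U)
            ≡ [ oddWhite h₁ ]· a r c h₂ + [ oddWhite h₂ ]· a r c h₁
    ∑≡holes = trans (∑-cong Vs λ x _ → atVertex x)
                    (trans (∑-+ Vs (λ x → [ x ==ᵛ h₁ ]· [ oddWhite h₁ ]· a r c h₂)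
                                   (λ x → [ x ==ᵛ h₂ ]· [ oddWhite h₂ ]· a r c h₁))
                           (cong₂ _+_ (∑-gridVertices-point r c _ h₁∈) (∑-gridVertices-point r c _ h₂∈)))

  evenHole-a-even : ∀ {i j} → InGrid r c (i , j) → parity i ≡ false → parity j ≡ false → parity (a r c (i , j)) ≡ false
  evenHole-a-even {i} {j} h∈ even-i even-j = begin
    parity (a r c (i , j))
      ≡⟨ cong parity (+-identityʳ (a r c (i , j))) ⟨
    parity (a r c (i , j) + 0)
      ≡⟨ cong (λ b → parity (a r c (i , j) + [ b ∧ parity j ]· a r c (1 , 1))) even-i ⟨
    parity ([ oddWhite (1 , 1) ]· a r c (i , j) + [ oddWhite (i , j) ]· a r c (1 , 1))
      ≡⟨ whiteHolePair-even corner∈ h∈ refl (cong₂ _xor_ even-i even-j)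
                               (cong (_∧ (1 ≡ᵇ j)) (even⇒≢1 i even-i)) ⟩
    false ∎
    where
    open ≡-Reasoning
    corner∈ : InGrid r c (1 , 1)
    corner∈ = (s≤s z≤n , s≤s z≤n) , (s≤s z≤n , s≤s z≤n)

  oddHoles-a-parity : ∀ {h₁ h₂} → InGrid r c h₁ → InGrid r c h₂ → oddWhite h₁ ≡ true → oddWhite h₂ ≡ true →
                      parity (a r c h₁) ≡ parity (a r c h₂)
  oddHoles-a-parity {h₁} {h₂} h₁∈ h₂∈ odd₁ odd₂ with h₁ ==ᵛ h₂ in h₁=h₂
  ... | true rewrite ==ᵛ⇒≡ h₁ h₂ h₁=h₂ = refl
  ... | false = sym (even-sum⇒same-parity (a r c h₂) (a r c h₁) holes-even)
    where
    holes-even : parity (a r c h₂ + a r c h₁) ≡ false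
    holes-even = subst₂ (λ b₁ b₂ → parity ([ b₁ ]· a r c h₂ + [ b₂ ]· a r c h₁) ≡ false) odd₁ odd₂
                   (whiteHolePair-even h₁∈ h₂∈ (oddWhite⇒white h₁ odd₁) (oddWhite⇒white h₂ odd₂) h₁=h₂)

lemma8 : (r c : ℕ) → r % 2 ≡ 1 → c % 2 ≡ 1 →
    ((i j : ℕ) → 1 ≤ i → i ≤ r → 1 ≤ j → j ≤ c →
       i % 2 ≡ 0 → j % 2 ≡ 0 → a r c (i , j) % 2 ≡ 0)
    × ((i₁ j₁ i₂ j₂ : ℕ) → 1 ≤ i₁ → i₁ ≤ r → 1 ≤ j₁ → j₁ ≤ c →
       1 ≤ i₂ → i₂ ≤ r → 1 ≤ j₂ → j₂ ≤ c →
       i₁ % 2 ≡ 1 → j₁ % 2 ≡ 1 → i₂ % 2 ≡ 1 → j₂ % 2 ≡ 1 →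
       a r c (i₁ , j₁) % 2 ≡ a r c (i₂ , j₂) % 2)
lemma8 r c r-odd c-odd
  with p , refl ← odd⇒1+double r (%2-≡⇒parity-≡ r 1 r-odd)
  with q , refl ← odd⇒1+double c (%2-≡⇒parity-≡ c 1 c-odd) =
    (λ i j 1≤i i≤r 1≤j j≤c i-even j-even →
       parity-≡⇒%2-≡ (a r c (i , j)) 0 (evenHole-a-even ((1≤i , i≤r) , (1≤j , j≤c))
                                          (%2-≡⇒parity-≡ i 0 i-even) (%2-≡⇒parity-≡ j 0 j-even))) ,
    (λ i₁ j₁ i₂ j₂ 1≤i₁ i₁≤r 1≤j₁ j₁≤c 1≤i₂ i₂≤r 1≤j₂ j₂≤c i₁-odd j₁-odd i₂-odd j₂-odd →
       parity-≡⇒%2-≡ (a r c (i₁ , j₁)) (a r c (i₂ , j₂))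
         (oddHoles-a-parity ((1≤i₁ , i₁≤r) , (1≤j₁ , j₁≤c)) ((1≤i₂ , i₂≤r) , (1≤j₂ , j₂≤c))
           (cong₂ _∧_ (%2-≡⇒parity-≡ i₁ 1 i₁-odd) (%2-≡⇒parity-≡ j₁ 1 j₁-odd))
           (cong₂ _∧_ (%2-≡⇒parity-≡ i₂ 1 i₂-odd) (%2-≡⇒parity-≡ j₂ 1 j₂-odd))))
  where open OddGrid p q using (evenHole-a-even; oddHoles-a-parity)
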